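{- For a tree $T$, the graph obtained by adding to $T$ the edges produced by the algorithm tree-augment (described in the context) is 2-vertex-connected.
   Context: A graph is 2-vertex-connected if it is connected and remains connected after removing any single vertex. A representative of a tree is a vertex of degree at least $3$ that is adjacent to at least one leaf; for a representative $R_i$, $L_i$ denotes the set of leaves adjacent to $R_i$, $l_i=|L_i|$, and $d_i$ is the degree of $R_i$. A path-to-edge contraction replaces a path $u=u_1,u_2,\dots,u_r=v$ all of whose internal vertices have degree exactly $2$ by the single edge $\{u,v\}$ (deleting $u_2,\dots,u_{r-1}$); it is applied to such paths where both endpoints have degree at least $3$, or one endpoint has degree at least $3$ and the other is a leaf. The algorithm tree-augment($T$): if $T$ has exactly two leaves $x,y$, add the edge $\{x,y\}$ and stop. Otherwise, perform all path-to-edge contractions and compute the representatives. If there is exactly one representative (the contracted tree is a star), perform star-augment, which adds $\Delta-1$ edges among the leaves so that the result is 2-connected. Otherwise (non-star case): choose representatives $R_i,R_j$ of maximum and second-maximum degree; set $t=l_j-1$ if $d_i-l_i=1$ and $d_j-l_j=1$; if $d_i-l_i\neq 1$ and $d_j-l_j=1$, set $t=l_i$ when $\min(l_i,l_j)=l_i$ and $t=l_j-1$ otherwise; if $d_i-l_i=1$ and $d_j-l_j\neq1$, set $t=l_j$; otherwise $t=\min(l_i,l_j)$. Pick $t$ leaves $x_1,\dots,x_t\in L_i$ and $t$ leaves $y_1,\dots,y_t\in L_j$, add the edges $\{x_k,y_k\}$ ($1\le k\le t$), delete these $2t$ leaves to obtain a smaller tree, update the representatives, and repeat the procedure on the new tree.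 -}

module Defs where

open import Data.Nat using (ℕ; zero; suc; _+_; _∸_; _≤_; _≡ᵇ_; _≤ᵇ_; _⊓_)
open import Data.Fin using (Fin; _≟_)
open import Data.Bool using (Bool; true; false; _∧_; _∨_; not; if_then_else_)
open import Data.List using (List; []; _∷_; [_]; length; filterᵇ; zip; _++_; allFin)
open import Data.Bool.ListAction using (any)
open import Data.List.Membership.Propositional using (_∈_)
open import Data.List.Relation.Unary.Unique.Propositional using (Unique)
open import Data.List.Relation.Unary.All using (All)
open import Data.Product using (Σ; ∃; ∃-syntax; _×_; _,_)
open import Data.Sum using (_⊎_)
open import Data.Unit using (⊤)
open import Relation.Nullary using (¬_)
open import Relation.Nullary.Decidable using (⌊_⌋)
open import Relation.Binary.PropositionalEquality using (_≡_; _≢_)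

-- Finite simple graphs on (a subset of) the vertex type Fin n.
-- V v = true  : v is a vertex of the graph
-- E u v = true : {u,v} is an edge

record Graph (n : ℕ) : Set where
  field
    V : Fin n → Bool
    E : Fin n → Fin n → Bool

open Graph public

module _ {n : ℕ} where

  _==_ : Fin n → Fin n → Bool
  a == b = ⌊ a ≟ b ⌋

  _∈ᵇ_ : Fin n → List (Fin n) → Bool
  w ∈ᵇ ws = any (λ m → w == m) ws

  InV : Graph n → Fin n → Set
  InV G v = V G v ≡ true

  Adj : Graph n → Fin n → Fin n → Set
  Adj G u v = E G u v ≡ true

  WellFormed : Graph n → Set
  WellFormed G = (∀ u v → Adj G u v → Adj G v u)
               × (∀ u → ¬ Adj G u u)
               × (∀ u v → Adj G u v → InV G u × InV G v)

  data Walk (G : Graph n) : Fin n → Fin n → Set where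
    here : ∀ {u} → InV G u → Walk G u u
    step : ∀ {u w v} → Adj G u w → Walk G w v → Walk G u v

  Connected : Graph n → Set
  Connected G = (∃[ v ] InV G v) × (∀ u v → InV G u → InV G v → Walk G u v)

  Consecutive : Graph n → List (Fin n) → Set
  Consecutive G []           = ⊤
  Consecutive G (x ∷ [])     = InV G x
  Consecutive G (x ∷ y ∷ xs) = Adj G x y × Consecutive G (y ∷ xs)

  IsPath : Graph n → Fin n → List (Fin n) → Fin n → Set
  IsPath G u mid v = Unique (u ∷ mid ++ [ v ]) × Consecutive G (u ∷ mid ++ [ v ])

  -- a cycle: a path with at least 3 vertices whose ends are adjacent
  HasCycle : Graph n → Set
  HasCycle G = ∃[ u ] ∃[ mid ] ∃[ v ] (mid ≢ []) × IsPath G u mid v × Adj G v u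

  Acyclic : Graph n → Set
  Acyclic G = ¬ HasCycle G

  Tree : Graph n → Set
  Tree G = WellFormed G × Connected G × Acyclic G

  count : (Fin n → Bool) → ℕ
  count p = length (filterᵇ p (allFin n))

  deg : Graph n → Fin n → ℕ
  deg G v = count (λ u → E G v u)

  IsLeaf : Graph n → Fin n → Set
  IsLeaf G v = InV G v × deg G v ≡ 1

  isLeafᵇ : Graph n → Fin n → Bool
  isLeafᵇ G v = V G v ∧ (deg G v ≡ᵇ 1)

  deleteVs : Graph n → List (Fin n) → Graph n
  deleteVs G ds = record
    { V = λ w → V G w ∧ not (w ∈ᵇ ds)
    ; E = λ a b → E G a b ∧ (V G a ∧ not (a ∈ᵇ ds)) ∧ (V G b ∧ not (b ∈ᵇ ds)) }

  addEdges : Graph n → List (Fin n × Fin n) → Graph n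
  addEdges G F = record
    { V = V G
    ; E = λ a b → E G a b ∨ any (λ { (x , y) → (a == x ∧ b == y) ∨ (a == y ∧ b == x) }) F }

  TwoConnected : Graph n → Set
  TwoConnected G = Connected G × (∀ v → InV G v → Connected (deleteVs G [ v ]))

  ContractiblePath : Graph n → Fin n → List (Fin n) → Fin n → Set
  ContractiblePath G u mid v =
      IsPath G u mid v × (mid ≢ [])
    × (∀ w → w ∈ mid → deg G w ≡ 2)
    × ( (3 ≤ deg G u × 3 ≤ deg G v)
      ⊎ (3 ≤ deg G u × IsLeaf G v)
      ⊎ (IsLeaf G u × 3 ≤ deg G v))

  contractAlong : Graph n → Fin n → List (Fin n) → Fin n → Graph n
  contractAlong G u mid v = record
    { V = V G'
    ; E = λ a b → E G' a b ∨ ((a == u ∧ b == v) ∨ (a == v ∧ b == u)) }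
    where G' = deleteVs G mid

  data FullyContracted : Graph n → Graph n → Set where
    done  : ∀ {G} → ¬ (∃[ u ] ∃[ mid ] ∃[ v ] ContractiblePath G u mid v)
          → FullyContracted G G
    step  : ∀ {G C} u mid v → ContractiblePath G u mid v
          → FullyContracted (contractAlong G u mid v) C → FullyContracted G C

  Representative : Graph n → Fin n → Set
  Representative G R = InV G R × 3 ≤ deg G R × (∃[ x ] Adj G R x × IsLeaf G x)

  leafCount : Graph n → Fin n → ℕ
  leafCount G R = count (λ u → E G R u ∧ isLeafᵇ G u)

  ExactlyTwoLeaves : Graph n → Fin n → Fin n → Set
  ExactlyTwoLeaves G x y =
    IsLeaf G x × IsLeaf G y × x ≢ y × (∀ z → IsLeaf G z → z ≡ x ⊎ z ≡ y)

  StarAugment : Graph n → Fin n → List (Fin n × Fin n) → Set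
  StarAugment C R F =
      length F ≡ deg C R ∸ 1
    × All (λ { (x , y) → IsLeaf C x × IsLeaf C y × x ≢ y }) F
    × TwoConnected (addEdges C F)

-- the number t of edges added between L_i and L_j
tval : (di li dj lj : ℕ) → ℕ
tval di li dj lj =
  if (di ∸ li) ≡ᵇ 1
  then (if (dj ∸ lj) ≡ᵇ 1 then lj ∸ 1 else lj)
  else (if (dj ∸ lj) ≡ᵇ 1 then (if li ≤ᵇ lj then li else lj ∸ 1) else li ⊓ lj)

module _ {n : ℕ} where
  -- TreeAugment G F : some run of tree-augment(G) adds exactly the edges F
  data TreeAugment : Graph n → List (Fin n × Fin n) → Set where
    twoLeaves : ∀ {G} x y → ExactlyTwoLeaves G x y → TreeAugment G ((x , y) ∷ [])
    star : ∀ {G C} F R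
         → ¬ (∃[ x ] ∃[ y ] ExactlyTwoLeaves G x y)
         → FullyContracted G C
         → Representative C R
         → (∀ R' → Representative C R' → R' ≡ R)
         → StarAugment C R F
         → TreeAugment G F
    nonStar : ∀ {G C F'} Ri Rj (xs ys : List (Fin n))
         → ¬ (∃[ x ] ∃[ y ] ExactlyTwoLeaves G x y)
         → FullyContracted G C
         → Representative C Ri → Representative C Rj → Ri ≢ Rj
         → (∀ R → Representative C R → deg C R ≤ deg C Ri)
         → (∀ R → Representative C R → R ≢ Ri → deg C R ≤ deg C Rj)
         → length xs ≡ tval (deg C Ri) (leafCount C Ri) (deg C Rj) (leafCount C Rj)
         → length ys ≡ tval (deg C Ri) (leafCount C Ri) (deg C Rj) (leafCount C Rj)
         → Unique xs → Unique ys
         → All (λ x → Adj C Ri x × IsLeaf C x) xs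
         → All (λ y → Adj C Rj y × IsLeaf C y) ys
         → TreeAugment (deleteVs C (xs ++ ys)) F'
         → TreeAugment G (zip xs ys ++ F')

-- Every edge of a tree is a bridge, and this invariant (with connectedness) is all that is used
-- about trees: it survives deleting leaves and contracting paths.  A tree with exactly two leaves becomes 2-connected when they are joined, since
-- from any vertex a leaf can be reached while avoiding any other given vertex.  In the star case
-- 2-connectivity of the contracted augmentation is part of the specification of star-augment.
-- In the non-star case the deleted leaves hang off Rᵢ and Rⱼ and are joined in pairs, so each of
-- them still reaches Rᵢ or Rⱼ after the removal of any single vertex.  Finally, 2-connectivity
-- survives undoing a contraction, i.e. subdividing the edge {u , v} back into the path: when an
-- interior vertex of the path is removed, u and v stay connected around a third vertex, which
-- exists because an end of the path has degree at least 3 and every edge is a bridge.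

module Submission where

open import Defs
open import Data.Nat using (ℕ; zero; suc; _+_; _≤_; _<_; z≤n; s≤s) renaming (_≟_ to _≟ℕ_)
open import Data.Nat.Properties using (≤-reflexive; +-suc; +-identityʳ; m≤n+m; suc-injective; ≤⇒≯; ≤∧≢⇒<)
open import Data.Fin using (Fin; _≟_)
open import Data.Fin.Properties using (any?)
open import Data.Bool using (Bool; true; false; _∧_; _∨_; not; T; T?)
open import Data.Bool.Properties using (∧-conicalˡ; ∧-conicalʳ; T-≡) renaming (_≟_ to _≟ᵇ_)
open import Data.List using (List; []; _∷_; [_]; length; zip; _++_; allFin; initLast; _∷ʳ′_)
open import Data.List.Properties using (length-++; length-tabulate; ++-assoc)
open import Data.Bool.ListAction using (any)
open import Data.List.Membership.Propositional using (_∈_; _∉_)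
open import Data.List.Membership.Propositional.Properties
  using (∈-++⁺ˡ; ∈-++⁺ʳ; ∈-++⁻; ∈-∃++; ∈-allFin; ∈-filter⁺; ∈-filter⁻)
import Data.List.Membership.DecPropositional as DecMembership
open import Data.List.Relation.Binary.Subset.Propositional using (_⊆_)
open import Data.List.Relation.Unary.Any using (here; there)
open import Data.List.Relation.Unary.All using (All; []; _∷_; lookup; tabulate)
import Data.List.Relation.Unary.All as All
open import Data.List.Relation.Unary.All.Properties using (¬Any⇒All¬)
open import Data.List.Relation.Unary.AllPairs using ([]; _∷_; uncons)
open import Data.List.Relation.Unary.Unique.Propositional using (Unique)
open import Data.List.Relation.Unary.Unique.Propositional.Properties using (allFin⁺; filter⁺; Unique[x∷xs]⇒x∉xs)
open import Data.Product using (Σ; ∃-syntax; _×_; _,_; proj₁; proj₂)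
open import Data.Sum using (_⊎_; inj₁; inj₂; [_,_]′; swap)
open import Data.Unit using (tt)
open import Data.Empty using (⊥-elim)
open import Function using (_∘_; Equivalence)
open import Relation.Nullary using (¬_; Dec; yes; no)
open import Relation.Nullary.Decidable using (toWitness; _×-dec_; _⊎-dec_; ¬?)
open import Relation.Binary.PropositionalEquality using (_≡_; _≢_; refl; sym; trans; cong; subst)

private
  variable
    n : ℕ
    A : Set
    p q : Bool

∧-true : p ≡ true → q ≡ true → p ∧ q ≡ true
∧-true refl refl = refl

∨-trueˡ : p ≡ true → p ∨ q ≡ true
∨-trueˡ refl = refl

∨-trueʳ : q ≡ true → p ∨ q ≡ true
∨-trueʳ {p = true}  _ = refl
∨-trueʳ {p = false} e = e

∨-true⁻ : p ∨ q ≡ true → p ≡ true ⊎ q ≡ true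
∨-true⁻ {p = true}  _ = inj₁ refl
∨-true⁻ {p = false} e = inj₂ e

not-true⁻ : not p ≡ true → p ≡ false
not-true⁻ {p = false} _ = refl

true≢false : p ≡ true → p ≢ false
true≢false refl ()

==-refl : (x : Fin n) → (x == x) ≡ true
==-refl x with x ≟ x
... | yes _  = refl
... | no x≢x = ⊥-elim (x≢x refl)

==⇒≡ : {x y : Fin n} → (x == y) ≡ true → x ≡ y
==⇒≡ e = toWitness (subst T (sym e) tt)

SameEdge : Fin n → Fin n → Fin n → Fin n → Set
SameEdge a b c d = (c ≡ a × d ≡ b) ⊎ (c ≡ b × d ≡ a)

SameEdge-sym : {a b c d : Fin n} → SameEdge a b c d → SameEdge a b d c
SameEdge-sym (inj₁ (c≡a , d≡b)) = inj₂ (d≡b , c≡a)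
SameEdge-sym (inj₂ (c≡b , d≡a)) = inj₁ (d≡a , c≡b)

-- the boolean test by which addEdges and contractAlong recognise the edge {a , b}
sameEdgeᵇ : Fin n → Fin n → Fin n → Fin n → Bool
sameEdgeᵇ a b c d = (c == a ∧ d == b) ∨ (c == b ∧ d == a)

sameEdgeᵇ⇒SameEdge : {a b c d : Fin n} → sameEdgeᵇ a b c d ≡ true → SameEdge a b c d
sameEdgeᵇ⇒SameEdge {a = a} {b} {c} {d} e with ∨-true⁻ {p = c == a ∧ d == b} e
... | inj₁ p = inj₁ (==⇒≡ (∧-conicalˡ _ _ p) , ==⇒≡ (∧-conicalʳ (c == a) _ p))
... | inj₂ p = inj₂ (==⇒≡ (∧-conicalˡ _ _ p) , ==⇒≡ (∧-conicalʳ (c == b) _ p))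

SameEdge⇒sameEdgeᵇ : {a b c d : Fin n} → SameEdge a b c d → sameEdgeᵇ a b c d ≡ true
SameEdge⇒sameEdgeᵇ {a = a} {b} (inj₁ (refl , refl)) = ∨-trueˡ (∧-true (==-refl a) (==-refl b))
SameEdge⇒sameEdgeᵇ {a = a} {b} (inj₂ (refl , refl)) = ∨-trueʳ {p = b == a ∧ a == b} (∧-true (==-refl b) (==-refl a))

∈⇒∈ᵇ : {w : Fin n} {ws : List (Fin n)} → w ∈ ws → (w ∈ᵇ ws) ≡ true
∈⇒∈ᵇ {w = w} (here refl) = ∨-trueˡ (==-refl w)
∈⇒∈ᵇ (there i)             = ∨-trueʳ (∈⇒∈ᵇ i)

∈ᵇ⇒∈ : {w : Fin n} {ws : List (Fin n)} → (w ∈ᵇ ws) ≡ true → w ∈ ws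
∈ᵇ⇒∈ {w = w} {x ∷ ws} e with ∨-true⁻ {w == x} e
... | inj₁ p = here (==⇒≡ p)
... | inj₂ p = there (∈ᵇ⇒∈ p)

∉⇒∈ᵇfalse : {w : Fin n} {ws : List (Fin n)} → w ∉ ws → (w ∈ᵇ ws) ≡ false
∉⇒∈ᵇfalse {w = w} {ws} w∉ with w ∈ᵇ ws in eq
... | true  = ⊥-elim (w∉ (∈ᵇ⇒∈ eq))
... | false = refl

_∈?_ : (x : Fin n) (xs : List (Fin n)) → Dec (x ∈ xs)
_∈?_ = DecMembership._∈?_ _≟_

Unique⇒length≤ : {xs ys : List A} → Unique xs → xs ⊆ ys → length xs ≤ length ys
Unique⇒length≤ {xs = []} _ _ = z≤n
Unique⇒length≤ {xs = x ∷ xs} {ys} (x∉xs ∷ u) xs⊆ys with ∈-∃++ (xs⊆ys (here refl))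
... | pre , post , refl
  rewrite length-++ pre {x ∷ post} | +-suc (length pre) (length post)
  = s≤s (subst (length xs ≤_) (length-++ pre) (Unique⇒length≤ u xs⊆pre++post))
  where
  xs⊆pre++post : xs ⊆ pre ++ post
  xs⊆pre++post {y} y∈xs with ∈-++⁻ pre (xs⊆ys (there y∈xs))
  ... | inj₁ y∈pre          = ∈-++⁺ˡ y∈pre
  ... | inj₂ (here refl)    = ⊥-elim (lookup x∉xs y∈xs refl)
  ... | inj₂ (there y∈post) = ∈-++⁺ʳ pre y∈post

Unique-++⁻ʳ : (xs : List A) {ys : List A} → Unique (xs ++ ys) → Unique ys
Unique-++⁻ʳ []       u       = u
Unique-++⁻ʳ (x ∷ xs) (_ ∷ u) = Unique-++⁻ʳ xs u

Unique-++-disjoint : (xs : List A) {ys : List A} {y : A} → Unique (xs ++ ys) → y ∈ ys → y ∉ xs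
Unique-++-disjoint (x ∷ xs) (x∉ ∷ u) i (here refl) = lookup x∉ (∈-++⁺ʳ xs i) refl
Unique-++-disjoint (x ∷ xs) (_ ∷ u)  i (there j)   = Unique-++-disjoint xs u i j

∈-∉⇒≢ : {x y : A} {xs : List A} → x ∈ xs → y ∉ xs → x ≢ y
∈-∉⇒≢ x∈ y∉ refl = y∉ x∈

∉-∈⇒≢ : {x y : A} {xs : List A} → x ∉ xs → y ∈ xs → x ≢ y
∉-∈⇒≢ x∉ y∈ refl = x∉ y∈

Unique-head≢ : {x y : A} {xs : List A} → Unique (x ∷ xs) → y ∈ xs → x ≢ y
Unique-head≢ u i refl = Unique[x∷xs]⇒x∉xs u i

∈-zip⁻ : {xs ys : List A} {x y : A} → (x , y) ∈ zip xs ys → x ∈ xs × y ∈ ys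
∈-zip⁻ {xs = _ ∷ _} {_ ∷ _} (here refl) = here refl , here refl
∈-zip⁻ {xs = _ ∷ _} {_ ∷ _} (there i)   = let (p , q) = ∈-zip⁻ i in there p , there q

zip-partnerˡ : {xs ys : List A} {x : A} → length xs ≡ length ys → x ∈ xs → ∃[ y ] (x , y) ∈ zip xs ys
zip-partnerˡ {xs = _ ∷ _} {y ∷ _} _  (here refl) = y , here refl
zip-partnerˡ {xs = _ ∷ _} {_ ∷ _} eq (there i)   = let (y , j) = zip-partnerˡ (suc-injective eq) i in y , there j

zip-partnerʳ : {xs ys : List A} {y : A} → length xs ≡ length ys → y ∈ ys → ∃[ x ] (x , y) ∈ zip xs ys
zip-partnerʳ {xs = x ∷ _} {_ ∷ _} _  (here refl) = x , here refl
zip-partnerʳ {xs = _ ∷ _} {_ ∷ _} eq (there i)   = let (x , j) = zip-partnerʳ (suc-injective eq) i in x , there j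

private
  variable
    G H K : Graph n
    a b c d h t v x y z : Fin n
    ds : List (Fin n)
    F : List (Fin n × Fin n)

infixl 6 _∖_
_∖_ : Graph n → Fin n → Graph n
G ∖ z = deleteVs G [ z ]

∉[]⇒≢ : x ∉ [ z ] → x ≢ z
∉[]⇒≢ x∉ x≡z = x∉ (here x≡z)

≢⇒∉[] : x ≢ z → x ∉ [ z ]
≢⇒∉[] x≢z (here x≡z) = x≢z x≡z

module _ (G : Graph n) (ds : List (Fin n)) where

  deleteVs-InV⁺ : InV G x → x ∉ ds → InV (deleteVs G ds) x
  deleteVs-InV⁺ {x = x} iv x∉ rewrite iv | ∉⇒∈ᵇfalse {w = x} {ds} x∉ = refl

  deleteVs-InV⁻ : InV (deleteVs G ds) x → InV G x × x ∉ ds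
  deleteVs-InV⁻ {x = x} e =
    ∧-conicalˡ _ _ e , λ x∈ → true≢false (∈⇒∈ᵇ x∈) (not-true⁻ (∧-conicalʳ (V G x) _ e))

  deleteVs-Adj⁺ : Adj G c d → InV (deleteVs G ds) c → InV (deleteVs G ds) d → Adj (deleteVs G ds) c d
  deleteVs-Adj⁺ e ic id = ∧-true e (∧-true ic id)

  deleteVs-Adj⁻ : Adj (deleteVs G ds) c d → Adj G c d × InV (deleteVs G ds) c × InV (deleteVs G ds) d
  deleteVs-Adj⁻ {c = c} {d} e =
    ∧-conicalˡ _ _ e , ∧-conicalˡ _ _ rest , ∧-conicalʳ (V G c ∧ not (c ∈ᵇ ds)) _ rest
    where rest = ∧-conicalʳ (E G c d) _ e

∖-InV⁺ : (G : Graph n) → InV G x → x ≢ z → InV (G ∖ z) x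
∖-InV⁺ G iv x≢z = deleteVs-InV⁺ G _ iv (≢⇒∉[] x≢z)

∖-InV⁻ : (G : Graph n) → InV (G ∖ z) x → InV G x × x ≢ z
∖-InV⁻ G iv = let (iv′ , x∉) = deleteVs-InV⁻ G _ iv in iv′ , ∉[]⇒≢ x∉

Joins : List (Fin n × Fin n) → Fin n → Fin n → Set
Joins F c d = (c , d) ∈ F ⊎ (d , c) ∈ F

module _ (G : Graph n) (F : List (Fin n × Fin n)) where

  addEdges-Adj⁺ˡ : Adj G c d → Adj (addEdges G F) c d
  addEdges-Adj⁺ˡ = ∨-trueˡ

  addEdges-Adj⁺ʳ : Joins F c d → Adj (addEdges G F) c d
  addEdges-Adj⁺ʳ {c} {d} j = ∨-trueʳ {p = E G c d} (go F j)
    where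
    go : ∀ F → Joins F c d → any (λ (x , y) → sameEdgeᵇ x y c d) F ≡ true
    go (_ ∷ _) (inj₁ (here refl)) = ∨-trueˡ (SameEdge⇒sameEdgeᵇ {a = c} {d} (inj₁ (refl , refl)))
    go (_ ∷ _) (inj₂ (here refl)) = ∨-trueˡ (SameEdge⇒sameEdgeᵇ {a = d} {c} (inj₂ (refl , refl)))
    go (_ ∷ F) (inj₁ (there i))   = ∨-trueʳ (go F (inj₁ i))
    go (_ ∷ F) (inj₂ (there i))   = ∨-trueʳ (go F (inj₂ i))

  addEdges-Adj⁻ : Adj (addEdges G F) c d → Adj G c d ⊎ Joins F c d
  addEdges-Adj⁻ {c} {d} e = [ inj₁ , inj₂ ∘ go F ]′ (∨-true⁻ {p = E G c d} e)
    where
    go : ∀ F → any (λ (x , y) → sameEdgeᵇ x y c d) F ≡ true → Joins F c d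
    go ((x , y) ∷ F) e with ∨-true⁻ {p = sameEdgeᵇ x y c d} e
    ... | inj₂ rest = [ inj₁ ∘ there , inj₂ ∘ there ]′ (go F rest)
    ... | inj₁ hd with sameEdgeᵇ⇒SameEdge {a = x} {y} {c} {d} hd
    ...   | inj₁ (refl , refl) = inj₁ (here refl)
    ...   | inj₂ (refl , refl) = inj₂ (here refl)

record Undirected (G : Graph n) : Set where
  field
    Adj-sym  : Adj G c d → Adj G d c
    Adj⇒InVˡ : Adj G c d → InV G c
    Adj⇒InVʳ : Adj G c d → InV G d

open Undirected public

WellFormed⇒Undirected : WellFormed G → Undirected G
WellFormed⇒Undirected (sym , _ , ends) = record
  { Adj-sym  = sym _ _
  ; Adj⇒InVˡ = proj₁ ∘ ends _ _
  ; Adj⇒InVʳ = proj₂ ∘ ends _ _ }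

deleteVs-Undirected : (ds : List (Fin n)) → Undirected G → Undirected (deleteVs G ds)
deleteVs-Undirected {G = G} ds ud = record
  { Adj-sym  = λ e → let (e′ , ic , id) = deleteVs-Adj⁻ G ds e in deleteVs-Adj⁺ G ds (Adj-sym ud e′) id ic
  ; Adj⇒InVˡ = proj₁ ∘ proj₂ ∘ deleteVs-Adj⁻ G ds
  ; Adj⇒InVʳ = proj₂ ∘ proj₂ ∘ deleteVs-Adj⁻ G ds }

EdgesWithin : Graph n → List (Fin n × Fin n) → Set
EdgesWithin G F = All (λ (x , y) → InV G x × InV G y) F

EdgesWithin-mono : (∀ {c} → InV G c → InV H c) → EdgesWithin G F → EdgesWithin H F
EdgesWithin-mono f = All.map λ (ix , iy) → f ix , f iy

addEdges-Undirected : Undirected G → EdgesWithin G F → Undirected (addEdges G F)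
addEdges-Undirected {G = G} {F = F} ud within = record
  { Adj-sym  = λ e → [ addEdges-Adj⁺ˡ G F ∘ Adj-sym ud , addEdges-Adj⁺ʳ G F ∘ swap ]′ (addEdges-Adj⁻ G F e)
  ; Adj⇒InVˡ = λ e → [ Adj⇒InVˡ ud , proj₁ ∘ ends ]′ (addEdges-Adj⁻ G F e)
  ; Adj⇒InVʳ = λ e → [ Adj⇒InVʳ ud , proj₂ ∘ ends ]′ (addEdges-Adj⁻ G F e) }
  where
  ends : Joins F c d → InV G c × InV G d
  ends (inj₁ i) = lookup within i
  ends (inj₂ i) = let (p , q) = lookup within i in q , p

infix 4 _⊑_
record _⊑_ (G H : Graph n) : Set where
  field
    InV-⊑ : InV G c → InV H c
    Adj-⊑ : Adj G c d → Adj H c d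

open _⊑_ public

deleteVs-⊑ : (G : Graph n) (ds : List (Fin n)) → deleteVs G ds ⊑ G
deleteVs-⊑ G ds = record
  { InV-⊑ = proj₁ ∘ deleteVs-InV⁻ G ds ; Adj-⊑ = proj₁ ∘ deleteVs-Adj⁻ G ds }

deleteVs-antitone : (G : Graph n) (ds ds′ : List (Fin n)) → ds ⊆ ds′ → deleteVs G ds′ ⊑ deleteVs G ds
deleteVs-antitone G ds ds′ ds⊆ds′ = record { InV-⊑ = shrink ; Adj-⊑ = λ e →
    let (e′ , ic , id) = deleteVs-Adj⁻ G ds′ e in deleteVs-Adj⁺ G ds e′ (shrink ic) (shrink id) }
  where
  shrink : InV (deleteVs G ds′) c → InV (deleteVs G ds) c
  shrink iv = let (iv′ , c∉) = deleteVs-InV⁻ G ds′ iv in deleteVs-InV⁺ G ds iv′ (c∉ ∘ ds⊆ds′)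

addEdges-⊒ : (G : Graph n) (F : List (Fin n × Fin n)) → G ⊑ addEdges G F
addEdges-⊒ G F = record { InV-⊑ = λ iv → iv ; Adj-⊑ = addEdges-Adj⁺ˡ G F }

∖-mono : G ⊑ H → G ∖ z ⊑ H ∖ z
∖-mono {G = G} {H = H} {z = z} G⊑H = record { InV-⊑ = shift ; Adj-⊑ = λ e →
    let (e′ , ic , id) = deleteVs-Adj⁻ G [ z ] e in deleteVs-Adj⁺ H [ z ] (Adj-⊑ G⊑H e′) (shift ic) (shift id) }
  where
  shift : InV (G ∖ z) c → InV (H ∖ z) c
  shift iv = let (iv′ , c≢z) = ∖-InV⁻ G iv in ∖-InV⁺ H (InV-⊑ G⊑H iv′) c≢z

⊑-∖ : Undirected G → G ⊑ H → ¬ InV G z → G ⊑ H ∖ z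
⊑-∖ {G = G} {H = H} {z = z} ud G⊑H z∉G = record { InV-⊑ = shift ; Adj-⊑ = λ e →
    deleteVs-Adj⁺ H [ z ] (Adj-⊑ G⊑H e) (shift (Adj⇒InVˡ ud e)) (shift (Adj⇒InVʳ ud e)) }
  where
  shift : InV G c → InV (H ∖ z) c
  shift iv = ∖-InV⁺ H (InV-⊑ G⊑H iv) λ { refl → z∉G iv }

infixr 5 _++ʷ_
_++ʷ_ : Walk G x y → Walk G y z → Walk G x z
here _   ++ʷ q = q
step e p ++ʷ q = step e (p ++ʷ q)

Walk-InVʳ : Walk G x y → InV G y
Walk-InVʳ (here iv)  = iv
Walk-InVʳ (step _ p) = Walk-InVʳ p

Walk-InVˡ : Undirected G → Walk G x y → InV G x
Walk-InVˡ ud (here iv)  = iv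
Walk-InVˡ ud (step e _) = Adj⇒InVˡ ud e

edgeʷ : Undirected G → Adj G x y → Walk G x y
edgeʷ ud e = step e (here (Adj⇒InVʳ ud e))

reverseʷ : Undirected G → Walk G x y → Walk G y x
reverseʷ ud (here iv)  = here iv
reverseʷ ud (step e p) = reverseʷ ud p ++ʷ edgeʷ ud (Adj-sym ud e)

mapʷ : G ⊑ H → Walk G x y → Walk H x y
mapʷ G⊑H (here iv)  = here (InV-⊑ G⊑H iv)
mapʷ G⊑H (step e p) = step (Adj-⊑ G⊑H e) (mapʷ G⊑H p)

bindʷ : (∀ {c} → InV G c → InV H c) → (∀ {c d} → Adj G c d → Walk H c d) → Walk G x y → Walk H x y
bindʷ onV onE (here iv)  = here (onV iv)
bindʷ onV onE (step e p) = onE e ++ʷ bindʷ onV onE p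

hub⇒Connected : Undirected G → InV G h → (∀ {c} → InV G c → Walk G c h) → Connected G
hub⇒Connected ud ih toHub = (_ , ih) , λ _ _ ic id → toHub ic ++ʷ reverseʷ ud (toHub id)

Connected-∖⇒Connected : Undirected G → Adj G z y → y ≢ z → Connected (G ∖ z) → Connected G
Connected-∖⇒Connected {G = G} {z = z} {y = y} ud e y≢z con = hub⇒Connected ud iy toY
  where
  iy = Adj⇒InVʳ ud e
  toY : InV G c → Walk G c y
  toY {c} ic with c ≟ z
  ... | yes refl = edgeʷ ud e
  ... | no c≢z   = mapʷ (deleteVs-⊑ G [ z ]) (proj₂ con c y (∖-InV⁺ G ic c≢z) (∖-InV⁺ G iy y≢z))

Consecutive-head : Undirected G → {xs : List (Fin n)} → Consecutive G (x ∷ xs) → InV G x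
Consecutive-head ud {[]}    c       = c
Consecutive-head ud {_ ∷ _} (e , _) = Adj⇒InVˡ ud e

Consecutive-mono : (L : List (Fin n)) → (∀ {x} → x ∈ L → InV G x → InV K x)
                 → (∀ {x y} → x ∈ L → y ∈ L → Adj G x y → Adj K x y) → Consecutive G L → Consecutive K L
Consecutive-mono []           onV onE c       = tt
Consecutive-mono (x ∷ [])     onV onE c       = onV (here refl) c
Consecutive-mono (x ∷ y ∷ L) onV onE (e , c) =
  onE (here refl) (there (here refl)) e , Consecutive-mono (y ∷ L) (onV ∘ there) (λ i j → onE (there i) (there j)) c

Consecutive-⊑ : G ⊑ K → (L : List (Fin n)) → Consecutive G L → Consecutive K L
Consecutive-⊑ G⊑K L = Consecutive-mono L (λ _ → InV-⊑ G⊑K) (λ _ _ → Adj-⊑ G⊑K)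

Consecutive-∖ : Undirected G → (L : List (Fin n)) → z ∉ L → Consecutive G L → Consecutive (G ∖ z) L
Consecutive-∖ {G = G} {z = z} ud L z∉ = Consecutive-mono L (λ i iv → ∖-InV⁺ G iv (avoid i))
  (λ i j e → deleteVs-Adj⁺ G [ z ] e (∖-InV⁺ G (Adj⇒InVˡ ud e) (avoid i)) (∖-InV⁺ G (Adj⇒InVʳ ud e) (avoid j)))
  where
  avoid : x ∈ L → x ≢ z
  avoid i refl = z∉ i

Consecutive-++⁻ˡ : Undirected G → (xs : List (Fin n)) {ys : List (Fin n)} → Consecutive G (xs ++ ys) → Consecutive G xs
Consecutive-++⁻ˡ ud []           c       = tt
Consecutive-++⁻ˡ ud (x ∷ [])     c       = Consecutive-head ud c
Consecutive-++⁻ˡ ud (x ∷ y ∷ xs) (e , c) = e , Consecutive-++⁻ˡ ud (y ∷ xs) c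

Consecutive-++⁻ʳ : (xs : List (Fin n)) {ys : List (Fin n)} → Consecutive G (xs ++ ys) → Consecutive G ys
Consecutive-++⁻ʳ []           c       = c
Consecutive-++⁻ʳ (x ∷ [])     {[]}    c       = tt
Consecutive-++⁻ʳ (x ∷ [])     {_ ∷ _} (e , c) = c
Consecutive-++⁻ʳ (x ∷ y ∷ xs) (e , c) = Consecutive-++⁻ʳ (y ∷ xs) c

walk-from-head : Undirected G → {xs : List (Fin n)} → Consecutive G (x ∷ xs) → y ∈ x ∷ xs → Walk G x y
walk-from-head ud         c       (here refl) = here (Consecutive-head ud c)
walk-from-head ud {_ ∷ _} (e , c) (there i)   = step e (walk-from-head ud c i)

Consecutive-connects : Undirected G → {L : List (Fin n)} → Consecutive G L → x ∈ L → y ∈ L → Walk G x y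
Consecutive-connects ud {_ ∷ _} c i j = reverseʷ ud (walk-from-head ud c i) ++ʷ walk-from-head ud c j

segment-walk : Undirected G → (L : List (Fin n)) → Consecutive G L → z ∉ L → x ∈ L → y ∈ L → Walk (G ∖ z) x y
segment-walk {z = z} ud L c z∉ = Consecutive-connects (deleteVs-Undirected [ z ] ud) (Consecutive-∖ ud L z∉ c)

init-verticesʷ : {G : Graph n} {x y : Fin n} → Walk G x y → List (Fin n)
init-verticesʷ (here _)         = []
init-verticesʷ (step {x} _ p) = x ∷ init-verticesʷ p

verticesʷ : {G : Graph n} {x y : Fin n} → Walk G x y → List (Fin n)
verticesʷ {y = y} p = init-verticesʷ p ++ [ y ]

∈-verticesʷ-last : (p : Walk G x y) → y ∈ verticesʷ p
∈-verticesʷ-last p = ∈-++⁺ʳ (init-verticesʷ p) (here refl)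

∈-verticesʷ-head : (p : Walk G x y) → x ∈ verticesʷ p
∈-verticesʷ-head (here _)   = here refl
∈-verticesʷ-head (step _ _) = here refl

verticesʷ-Consecutive : (p : Walk G x y) → Consecutive G (verticesʷ p)
verticesʷ-Consecutive (here iv)             = iv
verticesʷ-Consecutive (step e (here iv))   = e , iv
verticesʷ-Consecutive (step e p@(step _ _)) = e , verticesʷ-Consecutive p

prefix-avoidingʷ : Undirected G → (p : Walk G x y) → h ∉ verticesʷ p → z ∈ verticesʷ p → Walk (G ∖ h) x z
prefix-avoidingʷ {G = G} ud (here iv) h∉ (here refl) = here (∖-InV⁺ G iv λ { refl → h∉ (here refl) })
prefix-avoidingʷ {G = G} {h = h} ud (step e p) h∉ (here refl) =
  here (∖-InV⁺ G (Adj⇒InVˡ ud e) λ { refl → h∉ (here refl) })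
prefix-avoidingʷ {G = G} {h = h} ud (step e p) h∉ (there i) =
  step (deleteVs-Adj⁺ G [ h ] e (∖-InV⁺ G (Adj⇒InVˡ ud e) λ { refl → h∉ (here refl) })
                                (∖-InV⁺ G (Walk-InVˡ ud p) λ { refl → h∉ (there (∈-verticesʷ-head p)) }))
       (prefix-avoidingʷ ud p (h∉ ∘ there) i)

IsPathʷ : Walk G x y → Set
IsPathʷ p = Unique (verticesʷ p)

length-verticesʷ≤n : ∀ {n} {G : Graph n} {x y : Fin n} (p : Walk G x y) → IsPathʷ p → length (verticesʷ p) ≤ n
length-verticesʷ≤n {n} p path =
  subst (length (verticesʷ p) ≤_) (length-tabulate {n = n} (λ i → i)) (Unique⇒length≤ path λ _ → ∈-allFin _)

suffixʷ : (p : Walk G x z) → y ∈ verticesʷ p → Σ (Walk G y z) λ q → IsPathʷ p → IsPathʷ q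
suffixʷ (here iv)  (here refl) = here iv , λ u → u
suffixʷ (step e p) (here refl) = step e p , λ u → u
suffixʷ (step e p) (there i)   = let (q , f) = suffixʷ p i in q , λ { (_ ∷ u) → f u }

loop-erase : {G : Graph n} {x y : Fin n} → Walk G x y → Σ (Walk G x y) IsPathʷ
loop-erase (here iv) = here iv , [] ∷ []
loop-erase {x = x} (step e p) with loop-erase p
... | q , q-path with x ∈? verticesʷ q
... | yes i = let (r , f) = suffixʷ q i in r , f q-path
... | no x∉ = step e q , ¬Any⇒All¬ _ x∉ ∷ q-path

-- Bridges

removeEdge : Graph n → Fin n → Fin n → Graph n
removeEdge G a b = record
  { V = V G
  ; E = λ c d → E G c d ∧ not (sameEdgeᵇ a b c d) }

module _ (G : Graph n) (a b : Fin n) where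

  removeEdge-Adj⁺ : Adj G c d → ¬ SameEdge a b c d → Adj (removeEdge G a b) c d
  removeEdge-Adj⁺ {c} {d} e other with sameEdgeᵇ a b c d in eq
  ... | true  = ⊥-elim (other (sameEdgeᵇ⇒SameEdge eq))
  ... | false = ∧-true e refl

  removeEdge-Adj⁻ : Adj (removeEdge G a b) c d → Adj G c d × ¬ SameEdge a b c d
  removeEdge-Adj⁻ {c} {d} e =
    ∧-conicalˡ _ _ e , λ same → true≢false (SameEdge⇒sameEdgeᵇ same) (not-true⁻ (∧-conicalʳ (E G c d) _ e))

  removeEdge-⊑ : removeEdge G a b ⊑ G
  removeEdge-⊑ = record { InV-⊑ = λ iv → iv ; Adj-⊑ = proj₁ ∘ removeEdge-Adj⁻ }

  removeEdge-Undirected : Undirected G → Undirected (removeEdge G a b)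
  removeEdge-Undirected ud = record
    { Adj-sym  = λ e → let (e′ , other) = removeEdge-Adj⁻ e in
                       removeEdge-Adj⁺ (Adj-sym ud e′) (other ∘ SameEdge-sym)
    ; Adj⇒InVˡ = Adj⇒InVˡ ud ∘ proj₁ ∘ removeEdge-Adj⁻
    ; Adj⇒InVʳ = Adj⇒InVʳ ud ∘ proj₁ ∘ removeEdge-Adj⁻ }

removeEdge-flip : {a b : Fin n} → removeEdge G a b ⊑ removeEdge G b a
removeEdge-flip {G = G} {a} {b} = record { InV-⊑ = λ iv → iv ; Adj-⊑ = λ e →
  let (e′ , other) = removeEdge-Adj⁻ G a b e in removeEdge-Adj⁺ G b a e′ (other ∘ swap) }

removeEdge-mono : {a b : Fin n} → G ⊑ H → removeEdge G a b ⊑ removeEdge H a b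
removeEdge-mono {G = G} {H = H} {a} {b} G⊑H = record { InV-⊑ = InV-⊑ G⊑H ; Adj-⊑ = λ e →
  let (e′ , other) = removeEdge-Adj⁻ G a b e in removeEdge-Adj⁺ H a b (Adj-⊑ G⊑H e′) other }

∖-⊑-removeEdge : {a b : Fin n} → G ∖ a ⊑ removeEdge G a b
∖-⊑-removeEdge {G = G} {a} {b} = record { InV-⊑ = proj₁ ∘ ∖-InV⁻ G ; Adj-⊑ = λ e →
  let (e′ , ic , id) = deleteVs-Adj⁻ G [ a ] e in
  removeEdge-Adj⁺ G a b e′ λ { (inj₁ (refl , _)) → proj₂ (∖-InV⁻ G ic) refl
                       ; (inj₂ (_ , refl)) → proj₂ (∖-InV⁻ G id) refl } }

Bridge : Graph n → Fin n → Fin n → Set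
Bridge G a b = ¬ Walk (removeEdge G a b) a b

AllBridges : Graph n → Set
AllBridges G = ∀ {a b} → Adj G a b → Bridge G a b

bridges⇒no-detour : Undirected G → AllBridges G → Adj G x y → Adj G x z → y ≢ z → ¬ Walk (G ∖ x) z y
bridges⇒no-detour {G = G} {x = x} {y} ud bridges xy xz y≢z p =
  bridges xy (step (removeEdge-Adj⁺ G x y xz other) (mapʷ ∖-⊑-removeEdge p))
  where
  other : ¬ SameEdge x y x _
  other (inj₁ (_ , refl)) = y≢z refl
  other (inj₂ (refl , refl)) = y≢z refl

Tree⇒AllBridges : Tree G → AllBridges G
Tree⇒AllBridges {G = G} ((sym , loopless , _) , _ , acyclic) {a} {b} ab p with loop-erase p
... | here _ , _               = loopless a ab
... | step e (here _) , _      = proj₂ (removeEdge-Adj⁻ G a b e) (inj₁ (refl , refl))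
... | step e q@(step _ _) , path =
  acyclic (a , init-verticesʷ q , b , (λ ()) , (path , cycle) , sym a b ab)
  where cycle = Consecutive-⊑ (removeEdge-⊑ G a b) (verticesʷ (step e q)) (verticesʷ-Consecutive (step e q))

record Treelike (G : Graph n) : Set where
  field
    wellFormed : WellFormed G
    connected  : Connected G
    bridges    : AllBridges G

  undirected : Undirected G
  undirected = WellFormed⇒Undirected wellFormed

  loopless : ¬ Adj G x x
  loopless = proj₁ (proj₂ wellFormed) _

Tree⇒Treelike : Tree G → Treelike G
Tree⇒Treelike tree@(wf , con , _) = record { wellFormed = wf ; connected = con ; bridges = Tree⇒AllBridges tree }

count-≥ : (p : Fin n → Bool) {xs : List (Fin n)} → Unique xs → (∀ {x} → x ∈ xs → p x ≡ true)
        → length xs ≤ count p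
count-≥ p u holds = Unique⇒length≤ u λ i → ∈-filter⁺ (T? ∘ p) (∈-allFin _) (Equivalence.from T-≡ (holds i))

count-≤ : (p : Fin n → Bool) (xs : List (Fin n)) → (∀ {x} → p x ≡ true → x ∈ xs) → count p ≤ length xs
count-≤ {n} p xs covers = Unique⇒length≤ (filter⁺ (T? ∘ p) (allFin⁺ n))
  λ i → covers (Equivalence.to T-≡ (proj₂ (∈-filter⁻ (T? ∘ p) {xs = allFin n} i)))

module _ (G : Graph n) {w : Fin n} where

  neighbour-outside : (xs : List (Fin n)) → length xs < deg G w → ∃[ x ] Adj G w x × x ∉ xs
  neighbour-outside xs lt with any? (λ x → (E G w x ≟ᵇ true) ×-dec ¬? (x ∈? xs))
  ... | yes found = found
  ... | no none   = ⊥-elim (≤⇒≯ (count-≤ (E G w) xs covered) lt)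
    where
    covered : ∀ {x} → Adj G w x → x ∈ xs
    covered {x} e with x ∈? xs
    ... | yes i  = i
    ... | no x∉ = ⊥-elim (none (x , e , x∉))

  neighbours-within : {xs : List (Fin n)} → Unique xs → All (Adj G w) xs → deg G w ≤ length xs → Adj G w x → x ∈ xs
  neighbours-within {x = x} {xs} u adj le e with x ∈? xs
  ... | yes i  = i
  ... | no x∉ = ⊥-elim (≤⇒≯ le (count-≥ (E G w) (¬Any⇒All¬ _ x∉ ∷ u) adjacent))
    where
    adjacent : y ∈ x ∷ xs → Adj G w y
    adjacent (here refl) = e
    adjacent (there i)   = lookup adj i

  leaf-neighbour-unique : deg G w ≡ 1 → Adj G w x → Adj G w y → y ≡ x
  leaf-neighbour-unique d e e′ with neighbours-within ([] ∷ []) (e ∷ []) (≤-reflexive d) e′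
  ... | here y≡x = y≡x

  deg2-neighbours : deg G w ≡ 2 → Adj G w x → Adj G w y → x ≢ y → Adj G w z → z ≡ x ⊎ z ≡ y
  deg2-neighbours d ex ey x≢y ez with neighbours-within ((x≢y ∷ []) ∷ [] ∷ []) (ex ∷ ey ∷ []) (≤-reflexive d) ez
  ... | here z≡x         = inj₁ z≡x
  ... | there (here z≡y) = inj₂ z≡y

  other-neighbour : deg G w ≢ 1 → Adj G w x → ∃[ y ] Adj G w y × y ≢ x
  other-neighbour {x = x} d≢1 e =
    let 1≤deg         = count-≥ (E G w) ([] ∷ []) λ { (here refl) → e }
        (y , e′ , y∉) = neighbour-outside [ x ] (≤∧≢⇒< 1≤deg (d≢1 ∘ sym))
    in y , e′ , ∉[]⇒≢ y∉

  third-neighbour : 3 ≤ deg G w → (x y : Fin n) → ∃[ z ] Adj G w z × z ≢ x × z ≢ y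
  third-neighbour d x y =
    let (z , e , z∉) = neighbour-outside (x ∷ y ∷ []) d in z , e , z∉ ∘ here , z∉ ∘ there ∘ here

WellFormed-deleteVs : (ds : List (Fin n)) → WellFormed G → WellFormed (deleteVs G ds)
WellFormed-deleteVs {G = G} ds wf@(_ , loopless , _) =
    (λ _ _ → Adj-sym ud) , (λ c → loopless c ∘ proj₁ ∘ deleteVs-Adj⁻ G ds)
  , λ _ _ e → Adj⇒InVˡ ud e , Adj⇒InVʳ ud e
  where ud = deleteVs-Undirected ds (WellFormed⇒Undirected wf)

AllBridges-deleteVs : (ds : List (Fin n)) → AllBridges G → AllBridges (deleteVs G ds)
AllBridges-deleteVs {G = G} ds bridges e p =
  bridges (proj₁ (deleteVs-Adj⁻ G ds e)) (mapʷ (removeEdge-mono (deleteVs-⊑ G ds)) p)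

-- a walk can only enter a leaf from its unique neighbour and must return there
skip-leaves : WellFormed G → (∀ {s} → s ∈ ds → deg G s ≡ 1)
            → InV (deleteVs G ds) x → InV (deleteVs G ds) y → Walk G x y → Walk (deleteVs G ds) x y
skip-leaves wf leaves ix iy (here _) = here ix
skip-leaves {G = G} {ds = ds} wf leaves ix iy (step {w = w} e p) with w ∈? ds
... | no w∉ = step (deleteVs-Adj⁺ G ds e ix iw) (skip-leaves wf leaves iw iy p)
  where iw = deleteVs-InV⁺ G ds (Adj⇒InVʳ (WellFormed⇒Undirected wf) e) w∉
... | yes w∈ with p
...   | here _ = ⊥-elim (proj₂ (deleteVs-InV⁻ G ds iy) w∈)
...   | step e′ p′ rewrite leaf-neighbour-unique G (leaves w∈) (proj₁ wf _ _ e) e′ = skip-leaves wf leaves ix iy p′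

Treelike-delete-leaves : Treelike G → (∀ {s} → s ∈ ds → deg G s ≡ 1) → InV (deleteVs G ds) x
                       → Treelike (deleteVs G ds)
Treelike-delete-leaves {G = G} {ds = ds} treelike leaves ix = record
  { wellFormed = WellFormed-deleteVs ds wellFormed
  ; connected  = (_ , ix) , λ c d ic id →
      skip-leaves wellFormed leaves ic id
        (proj₂ connected c d (proj₁ (deleteVs-InV⁻ G ds ic)) (proj₁ (deleteVs-InV⁻ G ds id)))
  ; bridges    = AllBridges-deleteVs ds bridges }
  where open Treelike treelike

module LeafReach {G : Graph n} (treelike : Treelike G) where

  open Treelike treelike

  -- Extending a path backwards never runs into the path itself (every edge is a bridge), so a
  -- leaf is reached after fewer than n extensions; the fuel counts them.
  leaf-beyond : (fuel : ℕ) {w q : Fin n} (e : Adj G w q) (r : Walk G q y)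
              → suc n ≤ length (verticesʷ (step e r)) + fuel → IsPathʷ (step e r)
              → ∃[ ℓ ] IsLeaf G ℓ × Walk (deleteVs G (verticesʷ r)) w ℓ
  leaf-beyond zero e r bound path = ⊥-elim (≤⇒≯ (length-verticesʷ≤n (step e r) path)
    (subst (suc n ≤_) (+-identityʳ _) bound))
  leaf-beyond (suc fuel) {w} {q} e r bound path@(w∉r ∷ r-path) with deg G w ≟ℕ 1
  ... | yes leaf = w , (Adj⇒InVˡ undirected e , leaf) , here iw
    where iw = deleteVs-InV⁺ G (verticesʷ r) (Adj⇒InVˡ undirected e) (Unique[x∷xs]⇒x∉xs path)
  ... | no ¬leaf with other-neighbour G ¬leaf e
  ...   | w′ , e′ , w′≢q with w′ ∈? verticesʷ (step e r)
  ...     | yes (here refl) = ⊥-elim (loopless e′)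
  ...     | yes (there w′∈r) = ⊥-elim (bridges⇒no-detour undirected bridges e′ e w′≢q
              (prefix-avoidingʷ undirected r (Unique[x∷xs]⇒x∉xs path) w′∈r))
  ...     | no w′∉ with leaf-beyond fuel (Adj-sym undirected e′) (step e r)
                         (subst (suc n ≤_) (+-suc _ fuel) bound) (¬Any⇒All¬ _ w′∉ ∷ path)
  ...       | ℓ , leaf , p =
    ℓ , leaf , step (deleteVs-Adj⁺ G (verticesʷ r) e′ iw iw′) (mapʷ (deleteVs-antitone G _ (verticesʷ (step e r)) there) p)
    where
    iw  = deleteVs-InV⁺ G (verticesʷ r) (Adj⇒InVˡ undirected e) (Unique[x∷xs]⇒x∉xs path)
    iw′ = deleteVs-InV⁺ G (verticesʷ r) (Adj⇒InVʳ undirected e′) (w′∉ ∘ there)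

  leaf-reachable-avoiding : InV G v → InV G x → x ≢ v → ∃[ ℓ ] IsLeaf G ℓ × Walk (G ∖ v) x ℓ
  leaf-reachable-avoiding {v = v} {x = x} iv ix x≢v with loop-erase (proj₂ connected x v ix iv)
  ... | here _ , _       = ⊥-elim (x≢v refl)
  ... | step e r , path =
    let (ℓ , leaf , p) = leaf-beyond n e r (s≤s (m≤n+m n _)) path
    in ℓ , leaf , mapʷ (deleteVs-antitone G [ v ] (verticesʷ r) λ { (here refl) → ∈-verticesʷ-last r }) p

two-leaves-TwoConnected : Treelike G → ExactlyTwoLeaves G x y → TwoConnected (addEdges G [ (x , y) ])
two-leaves-TwoConnected {G = G} {x} {y} treelike (leaf-x , leaf-y , x≢y , only) = connected-G⁺ , deletion
  where
  open Treelike treelike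
  open LeafReach treelike
  xy = [ (x , y) ]
  G⁺ = addEdges G xy
  ud-G⁺ : Undirected G⁺
  ud-G⁺ = addEdges-Undirected undirected ((proj₁ leaf-x , proj₁ leaf-y) ∷ [])
  connected-G⁺ : Connected G⁺
  connected-G⁺ = proj₁ connected , λ c d ic id → mapʷ (addEdges-⊒ G xy) (proj₂ connected c d ic id)
  leaves-joined : ∀ {ℓ h} → ℓ ≡ x ⊎ ℓ ≡ y → h ≡ x ⊎ h ≡ y
                → InV (G⁺ ∖ v) ℓ → InV (G⁺ ∖ v) h → Walk (G⁺ ∖ v) ℓ h
  leaves-joined {v} (inj₁ refl) (inj₁ refl) iℓ ih = here iℓ
  leaves-joined {v} (inj₂ refl) (inj₂ refl) iℓ ih = here iℓ
  leaves-joined {v} (inj₁ refl) (inj₂ refl) iℓ ih =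
    edgeʷ (deleteVs-Undirected [ v ] ud-G⁺) (deleteVs-Adj⁺ G⁺ [ v ] (addEdges-Adj⁺ʳ G xy (inj₁ (here refl))) iℓ ih)
  leaves-joined {v} (inj₂ refl) (inj₁ refl) iℓ ih =
    edgeʷ (deleteVs-Undirected [ v ] ud-G⁺) (deleteVs-Adj⁺ G⁺ [ v ] (addEdges-Adj⁺ʳ G xy (inj₂ (here refl))) iℓ ih)
  via-leaf : InV G v → (h : Fin _) → h ≡ x ⊎ h ≡ y → h ≢ v → IsLeaf G h → Connected (G⁺ ∖ v)
  via-leaf {v} iv h h-end h≢v leaf-h = hub⇒Connected (deleteVs-Undirected [ v ] ud-G⁺) ih to-h
    where
    ih = ∖-InV⁺ G⁺ (proj₁ leaf-h) h≢v
    to-h : InV (G⁺ ∖ v) c → Walk (G⁺ ∖ v) c h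
    to-h ic =
      let (ic′ , c≢v)    = ∖-InV⁻ G⁺ ic
          (ℓ , leaf , p) = leaf-reachable-avoiding iv ic′ c≢v
          p′             = mapʷ (∖-mono (addEdges-⊒ G xy)) p
      in p′ ++ʷ leaves-joined (only ℓ leaf) h-end (Walk-InVʳ p′) ih
  deletion : ∀ v → InV G⁺ v → Connected (G⁺ ∖ v)
  deletion v iv with x ≟ v
  ... | yes refl = via-leaf iv y (inj₂ refl) (x≢y ∘ sym) leaf-y
  ... | no x≢v   = via-leaf iv x (inj₁ refl) x≢v leaf-x

-- Attaching leaves joined in pairs

module Ear {C : Graph n} {Rᵢ Rⱼ : Fin n} {xs ys : List (Fin n)} {F′ : List (Fin n × Fin n)}
  (wf : WellFormed C) (Rᵢ≢Rⱼ : Rᵢ ≢ Rⱼ) (Rᵢ∉ : Rᵢ ∉ xs ++ ys) (Rⱼ∉ : Rⱼ ∉ xs ++ ys)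
  (iRᵢ : InV C Rᵢ) (iRⱼ : InV C Rⱼ) (xs-adj : All (Adj C Rᵢ) xs) (ys-adj : All (Adj C Rⱼ) ys)
  (same-length : length xs ≡ length ys) (within′ : EdgesWithin (deleteVs C (xs ++ ys)) F′)
  (two-connected′ : TwoConnected (addEdges (deleteVs C (xs ++ ys)) F′)) where

  private
    S : List (Fin n)
    S = xs ++ ys
    C′⁺ : Graph n
    C′⁺ = addEdges (deleteVs C S) F′
    F⁺ : List (Fin n × Fin n)
    F⁺ = zip xs ys ++ F′
    C⁺ : Graph n
    C⁺ = addEdges C F⁺
    ud : Undirected C
    ud = WellFormed⇒Undirected wf

  within : EdgesWithin C F⁺
  within = tabulate λ {(x , y)} i → ends (∈-++⁻ (zip xs ys) i)
    where
    ends : (x , y) ∈ zip xs ys ⊎ (x , y) ∈ F′ → InV C x × InV C y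
    ends (inj₁ j) = let (x∈ , y∈) = ∈-zip⁻ j in Adj⇒InVʳ ud (lookup xs-adj x∈) , Adj⇒InVʳ ud (lookup ys-adj y∈)
    ends (inj₂ j) = let (ix , iy) = lookup within′ j in proj₁ (deleteVs-InV⁻ C S ix) , proj₁ (deleteVs-InV⁻ C S iy)

  private
    ud-C⁺ : Undirected C⁺
    ud-C⁺ = addEdges-Undirected ud within

    C′⁺⊑C⁺ : C′⁺ ⊑ C⁺
    C′⁺⊑C⁺ = record
      { InV-⊑ = proj₁ ∘ deleteVs-InV⁻ C S
      ; Adj-⊑ = λ e → [ addEdges-Adj⁺ˡ C F⁺ ∘ proj₁ ∘ deleteVs-Adj⁻ C S
                      , addEdges-Adj⁺ʳ C F⁺ ∘ [ inj₁ ∘ ∈-++⁺ʳ (zip xs ys) , inj₂ ∘ ∈-++⁺ʳ (zip xs ys) ]′ ]′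
                      (addEdges-Adj⁻ (deleteVs C S) F′ e) }

    InV-C′⁺ : InV C c → c ∉ S → InV C′⁺ c
    InV-C′⁺ = deleteVs-InV⁺ C S

    step∖ : Adj C⁺ c d → c ≢ z → d ≢ z → Walk (C⁺ ∖ z) d h → Walk (C⁺ ∖ z) c h
    step∖ {z = z} e c≢z d≢z =
      step (deleteVs-Adj⁺ C⁺ [ z ] e (∖-InV⁺ C⁺ (Adj⇒InVˡ ud-C⁺ e) c≢z) (∖-InV⁺ C⁺ (Adj⇒InVʳ ud-C⁺ e) d≢z))

    own-leaf : InV C h → Adj C h c → c ≢ z → h ≢ z → Walk (C⁺ ∖ z) c h
    own-leaf ih e c≢z h≢z = step∖ (addEdges-Adj⁺ˡ C F⁺ (Adj-sym ud e)) c≢z h≢z (here (∖-InV⁺ C⁺ ih h≢z))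

    partner-leaf : Joins (zip xs ys) c d → InV C h → Adj C h d → c ≢ z → d ≢ z → h ≢ z → Walk (C⁺ ∖ z) c h
    partner-leaf j ih e c≢z d≢z h≢z =
      step∖ (addEdges-Adj⁺ʳ C F⁺ ([ inj₁ ∘ ∈-++⁺ˡ , inj₂ ∘ ∈-++⁺ˡ ]′ j)) c≢z d≢z (own-leaf ih e d≢z h≢z)

    delete-paired : z ∈ S → Connected (C⁺ ∖ z)
    delete-paired {z = z} z∈ = hub⇒Connected (deleteVs-Undirected [ z ] ud-C⁺) (∖-InV⁺ C⁺ iRᵢ Rᵢ≢z) to-Rᵢ
      where
      Rᵢ≢z = ∉-∈⇒≢ Rᵢ∉ z∈
      Rⱼ≢z = ∉-∈⇒≢ Rⱼ∉ z∈
      z∉C′⁺ : ¬ InV C′⁺ z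
      z∉C′⁺ iz = proj₂ (deleteVs-InV⁻ C S iz) z∈
      inside : c ∉ S → InV C c → Walk (C⁺ ∖ z) c Rᵢ
      inside c∉ ic = mapʷ (⊑-∖ (addEdges-Undirected (deleteVs-Undirected S ud) within′) C′⁺⊑C⁺ z∉C′⁺)
                          (proj₂ (proj₁ two-connected′) _ _ (InV-C′⁺ ic c∉) (InV-C′⁺ iRᵢ Rᵢ∉))
      to-Rᵢ : InV (C⁺ ∖ z) c → Walk (C⁺ ∖ z) c Rᵢ
      to-Rᵢ {c} ic with ∖-InV⁻ C⁺ ic | c ∈? S
      ... | ic′ , _   | no c∉ = inside c∉ ic′
      ... | _ , c≢z | yes c∈ with ∈-++⁻ xs c∈
      ...   | inj₁ c∈xs = own-leaf iRᵢ (lookup xs-adj c∈xs) c≢z Rᵢ≢z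
      ...   | inj₂ c∈ys = own-leaf iRⱼ (lookup ys-adj c∈ys) c≢z Rⱼ≢z ++ʷ inside Rⱼ∉ iRⱼ

    delete-unpaired : InV C z → z ∉ S → InV C h → h ∉ S → h ≢ z
                    → (∀ {c} → c ∈ S → Walk (C⁺ ∖ z) c h) → Connected (C⁺ ∖ z)
    delete-unpaired {z = z} {h = h} iz z∉ ih h∉ h≢z paired-to-h =
      hub⇒Connected (deleteVs-Undirected [ z ] ud-C⁺) (∖-InV⁺ C⁺ ih h≢z) to-h
      where
      to-h : InV (C⁺ ∖ z) c → Walk (C⁺ ∖ z) c h
      to-h {c} ic with ∖-InV⁻ C⁺ ic | c ∈? S
      ... | _         | yes c∈ = paired-to-h c∈
      ... | ic′ , c≢z | no c∉  = mapʷ (∖-mono C′⁺⊑C⁺) (proj₂ (proj₂ two-connected′ z (InV-C′⁺ iz z∉)) _ _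
                                   (∖-InV⁺ C′⁺ (InV-C′⁺ ic′ c∉) c≢z) (∖-InV⁺ C′⁺ (InV-C′⁺ ih h∉) h≢z))

    delete : ∀ z → InV C⁺ z → Connected (C⁺ ∖ z)
    delete z iz with z ∈? S
    ... | yes z∈ = delete-paired z∈
    ... | no z∉ with Rᵢ ≟ z
    ...   | no Rᵢ≢z = delete-unpaired iz z∉ iRᵢ Rᵢ∉ Rᵢ≢z to-Rᵢ
      where
      to-Rᵢ : c ∈ S → Walk (C⁺ ∖ z) c Rᵢ
      to-Rᵢ c∈ with ∈-++⁻ xs c∈
      ... | inj₁ c∈xs = own-leaf iRᵢ (lookup xs-adj c∈xs) (∈-∉⇒≢ c∈ z∉) Rᵢ≢z
      ... | inj₂ c∈ys with zip-partnerʳ same-length c∈ys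
      ...   | x , j = let x∈xs = proj₁ (∈-zip⁻ j) in
        partner-leaf (inj₂ j) iRᵢ (lookup xs-adj x∈xs) (∈-∉⇒≢ c∈ z∉) (∈-∉⇒≢ (∈-++⁺ˡ x∈xs) z∉) Rᵢ≢z
    ...   | yes refl = delete-unpaired iz z∉ iRⱼ Rⱼ∉ (Rᵢ≢Rⱼ ∘ sym) to-Rⱼ
      where
      to-Rⱼ : c ∈ S → Walk (C⁺ ∖ Rᵢ) c Rⱼ
      to-Rⱼ c∈ with ∈-++⁻ xs c∈
      ... | inj₂ c∈ys = own-leaf iRⱼ (lookup ys-adj c∈ys) (∈-∉⇒≢ c∈ z∉) (Rᵢ≢Rⱼ ∘ sym)
      ... | inj₁ c∈xs with zip-partnerˡ same-length c∈xs
      ...   | y , j = let y∈ys = proj₂ (∈-zip⁻ j) in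
        partner-leaf (inj₁ j) iRⱼ (lookup ys-adj y∈ys) (∈-∉⇒≢ c∈ z∉) (∈-∉⇒≢ (∈-++⁺ʳ xs y∈ys) z∉) (Rᵢ≢Rⱼ ∘ sym)

  ear-TwoConnected : Adj C Rᵢ t → TwoConnected C⁺
  ear-TwoConnected {t = t} e = Connected-∖⇒Connected ud-C⁺ (addEdges-Adj⁺ˡ C F⁺ e) t≢Rᵢ (delete Rᵢ iRᵢ) , delete
    where t≢Rᵢ = λ { refl → proj₁ (proj₂ wf) t e }

-- Path-to-edge contraction

interior-neighbours : Undirected G → (x : Fin n) (ms : List (Fin n)) (z : Fin n) {m : Fin n}
  → Unique (x ∷ ms ++ [ z ]) → Consecutive G (x ∷ ms ++ [ z ]) → m ∈ ms
  → ∃[ p ] ∃[ q ] p ∈ x ∷ ms ++ [ z ] × q ∈ x ∷ ms ++ [ z ] × p ≢ q × Adj G m p × Adj G m q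
interior-neighbours {G = G} ud x (m ∷ rest) z u (e , c) (here refl) =
  let (q , q∈ , e′) = successor rest c
  in x , q , here refl , there (there q∈) , Unique-head≢ u (there q∈) , Adj-sym ud e , e′
  where
  successor : ∀ rest → Consecutive G (m ∷ rest ++ [ z ]) → ∃[ q ] q ∈ rest ++ [ z ] × Adj G m q
  successor []      c = z , here refl , proj₁ c
  successor (y ∷ _) c = y , here refl , proj₁ c
interior-neighbours ud x (m′ ∷ rest) z (_ ∷ u) (_ , c) (there i) =
  let (p , q , p∈ , q∈ , p≢q , ep , eq) = interior-neighbours ud m′ rest z u c i
  in p , q , there p∈ , there q∈ , p≢q , ep , eq

module Contraction {G : Graph n} {u v : Fin n} {mid : List (Fin n)}
  (wf : WellFormed G) (cp : ContractiblePath G u mid v) where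

  private
    L : List (Fin n)
    L = u ∷ mid ++ [ v ]
    ud : Undirected G
    ud = WellFormed⇒Undirected wf
    G′ : Graph n
    G′ = deleteVs G mid
    ud′ : Undirected G′
    ud′ = deleteVs-Undirected mid ud

  Gᶜ : Graph n
  Gᶜ = contractAlong G u mid v

  path-unique : Unique L
  path-unique = proj₁ (proj₁ cp)

  path-consecutive : Consecutive G L
  path-consecutive = proj₂ (proj₁ cp)

  u∉mid : u ∉ mid
  u∉mid i = Unique-head≢ path-unique (∈-++⁺ˡ i) refl

  v∉mid : v ∉ mid
  v∉mid = Unique-++-disjoint mid (proj₂ (uncons path-unique)) (here refl)

  u≢v : u ≢ v
  u≢v = Unique-head≢ path-unique (∈-++⁺ʳ mid (here refl))

  ∈L⇒end : x ∈ L → x ∉ mid → x ≡ u ⊎ x ≡ v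
  ∈L⇒end (here x≡u) _ = inj₁ x≡u
  ∈L⇒end (there i) x∉ with ∈-++⁻ mid i
  ... | inj₁ x∈ = ⊥-elim (x∉ x∈)
  ... | inj₂ (here x≡v) = inj₂ x≡v

  iu : InV G u
  iu = Consecutive-head ud path-consecutive

  iv : InV G v
  iv = Walk-InVʳ (walk-from-head ud path-consecutive (there (∈-++⁺ʳ mid (here refl))))

  iuᶜ : InV Gᶜ u
  iuᶜ = deleteVs-InV⁺ G mid iu u∉mid

  ivᶜ : InV Gᶜ v
  ivᶜ = deleteVs-InV⁺ G mid iv v∉mid

  Gᶜ-Adj⁻ : Adj Gᶜ x y → Adj G′ x y ⊎ SameEdge u v x y
  Gᶜ-Adj⁻ {x} {y} e = [ inj₁ , inj₂ ∘ sameEdgeᵇ⇒SameEdge ]′ (∨-true⁻ {p = E G′ x y} e)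

  G′⊑Gᶜ : G′ ⊑ Gᶜ
  G′⊑Gᶜ = record { InV-⊑ = λ iv → iv ; Adj-⊑ = ∨-trueˡ }

  Gᶜ-Adj-uv : SameEdge u v x y → Adj Gᶜ x y
  Gᶜ-Adj-uv {x} {y} same = ∨-trueʳ {p = E G′ x y} (SameEdge⇒sameEdgeᵇ same)

  Gᶜ-Adj⁻-mid : Adj Gᶜ x y → Adj G x y × x ∉ mid × y ∉ mid ⊎ SameEdge u v x y
  Gᶜ-Adj⁻-mid e with Gᶜ-Adj⁻ e
  ... | inj₂ same = inj₂ same
  ... | inj₁ e′ = let (e″ , ix , iy) = deleteVs-Adj⁻ G mid e′
                  in inj₁ (e″ , proj₂ (deleteVs-InV⁻ G mid ix) , proj₂ (deleteVs-InV⁻ G mid iy))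

  WellFormed-Gᶜ : WellFormed Gᶜ
  WellFormed-Gᶜ = (λ _ _ → sym′) , (λ _ → loopless′) , λ _ _ e → ends e
    where
    sym′ : Adj Gᶜ x y → Adj Gᶜ y x
    sym′ e = [ Adj-⊑ G′⊑Gᶜ ∘ Adj-sym ud′ , Gᶜ-Adj-uv ∘ SameEdge-sym ]′ (Gᶜ-Adj⁻ e)
    loopless′ : ¬ Adj Gᶜ x x
    loopless′ e with Gᶜ-Adj⁻ e
    ... | inj₁ e′              = proj₁ (proj₂ wf) _ (proj₁ (deleteVs-Adj⁻ G mid e′))
    ... | inj₂ (inj₁ (refl , x≡v)) = u≢v x≡v
    ... | inj₂ (inj₂ (refl , x≡u)) = u≢v (sym x≡u)
    ends : Adj Gᶜ x y → InV Gᶜ x × InV Gᶜ y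
    ends e with Gᶜ-Adj⁻ e
    ... | inj₁ e′ = Adj⇒InVˡ ud′ e′ , Adj⇒InVʳ ud′ e′
    ... | inj₂ (inj₁ (refl , refl)) = iuᶜ , ivᶜ
    ... | inj₂ (inj₂ (refl , refl)) = ivᶜ , iuᶜ

  ud-Gᶜ : Undirected Gᶜ
  ud-Gᶜ = WellFormed⇒Undirected WellFormed-Gᶜ

  mid-exit : {m : Fin n} → m ∈ mid → Adj G m x → x ∉ mid → x ≡ u ⊎ x ≡ v
  mid-exit {x = x} m∈ e x∉ with interior-neighbours ud u mid v path-unique path-consecutive m∈
  ... | p , q , p∈ , q∈ , p≢q , ep , eq =
    ∈L⇒end ([ (λ x≡p → subst (_∈ L) (sym x≡p) p∈) , (λ x≡q → subst (_∈ L) (sym x≡q) q∈) ]′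
              (deg2-neighbours G (proj₁ (proj₂ (proj₂ cp)) _ m∈) ep eq p≢q e)) x∉

  -- a walk can only pass through the interior of the path from one end to the other
  mutual
    contractʷ : InV Gᶜ x → InV Gᶜ y → Walk G x y → Walk Gᶜ x y
    contractʷ ix iy (here _) = here ix
    contractʷ ix iy (step {w = w} e p) with w ∈? mid
    ... | no w∉ = step (Adj-⊑ G′⊑Gᶜ (deleteVs-Adj⁺ G mid e ix iw)) (contractʷ iw iy p)
      where iw = deleteVs-InV⁺ G mid (Adj⇒InVʳ ud e) w∉
    ... | yes w∈ with mid-exit w∈ (Adj-sym ud e) (proj₂ (deleteVs-InV⁻ G mid ix))
    ...   | inj₁ refl = from-interior w∈ iy p
    ...   | inj₂ refl = step (Gᶜ-Adj-uv (inj₂ (refl , refl))) (from-interior w∈ iy p)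

    from-interior : {w : Fin n} → w ∈ mid → InV Gᶜ y → Walk G w y → Walk Gᶜ u y
    from-interior w∈ iy (here _) = ⊥-elim (proj₂ (deleteVs-InV⁻ G mid iy) w∈)
    from-interior w∈ iy (step {w = w′} e p) with w′ ∈? mid
    ... | yes w′∈ = from-interior w′∈ iy p
    ... | no w′∉ with mid-exit w∈ e w′∉
    ...   | inj₁ refl = contractʷ iuᶜ iy p
    ...   | inj₂ refl = step (Gᶜ-Adj-uv (inj₁ (refl , refl))) (contractʷ ivᶜ iy p)

  Connected-Gᶜ : Connected G → Connected Gᶜ
  Connected-Gᶜ con = (u , iuᶜ) , λ x y ix iy →
    contractʷ ix iy (proj₂ con x y (proj₁ (deleteVs-InV⁻ G mid ix)) (proj₁ (deleteVs-InV⁻ G mid iy)))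

  prefix-avoiding : z ∉ u ∷ mid → x ∈ u ∷ mid → y ∈ u ∷ mid → Walk (G ∖ z) x y
  prefix-avoiding = segment-walk ud (u ∷ mid) (Consecutive-++⁻ˡ ud (u ∷ mid) path-consecutive)

  suffix-avoiding : z ∉ mid ++ [ v ] → x ∈ mid ++ [ v ] → y ∈ mid ++ [ v ] → Walk (G ∖ z) x y
  suffix-avoiding = segment-walk ud (mid ++ [ v ]) (Consecutive-++⁻ʳ [ u ] path-consecutive)

  path-avoiding : z ∉ L → Walk (G ∖ z) u v
  path-avoiding z∉ = segment-walk ud L path-consecutive z∉ (here refl) (there (∈-++⁺ʳ mid (here refl)))

  u∉suffix : u ∉ mid ++ [ v ]
  u∉suffix = Unique[x∷xs]⇒x∉xs path-unique

  v∉prefix : v ∉ u ∷ mid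
  v∉prefix (here v≡u) = u≢v (sym v≡u)
  v∉prefix (there v∈) = v∉mid v∈

  mid-avoiding-u : x ∈ mid → y ∈ mid → Walk (G ∖ u) x y
  mid-avoiding-u i j = suffix-avoiding u∉suffix (∈-++⁺ˡ i) (∈-++⁺ˡ j)

  mid-avoiding-v : x ∈ mid → y ∈ mid → Walk (G ∖ v) x y
  mid-avoiding-v i j = prefix-avoiding v∉prefix (there i) (there j)

  first-interior : ∃[ m ] m ∈ mid × Adj G u m
  first-interior = go mid (proj₁ (proj₂ cp)) path-consecutive
    where
    go : ∀ ms → ms ≢ [] → Consecutive G (u ∷ ms ++ [ v ]) → ∃[ m ] m ∈ ms × Adj G u m
    go []      ms≢[] _       = ⊥-elim (ms≢[] refl)
    go (m ∷ _) _     (e , _) = m , here refl , e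

  module _ (bridges : AllBridges G) where

    private
      -- the contracted edge would close a cycle with the first edge of the path
      uv-bridge′ : ¬ Walk (removeEdge Gᶜ u v) u v
      uv-bridge′ p with first-interior
      ... | m₁ , m₁∈ , e = bridges e (mapʷ Gᶜ−uv⊑G−um₁ p ++ʷ mapʷ ∖-⊑-removeEdge v-to-m₁)
        where
        v-to-m₁ = suffix-avoiding u∉suffix (∈-++⁺ʳ mid (here refl)) (∈-++⁺ˡ m₁∈)
        Gᶜ−uv⊑G−um₁ : removeEdge Gᶜ u v ⊑ removeEdge G u m₁
        Gᶜ−uv⊑G−um₁ = record { InV-⊑ = proj₁ ∘ deleteVs-InV⁻ G mid ; Adj-⊑ = λ e →
          let (e′ , other) = removeEdge-Adj⁻ Gᶜ u v e in case (Gᶜ-Adj⁻-mid e′) other }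
          where
          case : Adj G x y × x ∉ mid × y ∉ mid ⊎ SameEdge u v x y → ¬ SameEdge u v x y → Adj (removeEdge G u m₁) x y
          case (inj₂ same) other = ⊥-elim (other same)
          case (inj₁ (e , x∉ , y∉)) _ = removeEdge-Adj⁺ G u m₁ e
            λ { (inj₁ (_ , refl)) → y∉ m₁∈ ; (inj₂ (refl , _)) → x∉ m₁∈ }

      uv-bridge : {a b : Fin n} → SameEdge u v a b → ¬ Walk (removeEdge Gᶜ a b) a b
      uv-bridge (inj₁ (refl , refl)) p = uv-bridge′ p
      uv-bridge (inj₂ (refl , refl)) p =
        uv-bridge′ (mapʷ removeEdge-flip (reverseʷ (removeEdge-Undirected Gᶜ v u ud-Gᶜ) p))

      -- an old edge keeps its bridge property since one of its ends lies off the path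
      other-bridge : {a b : Fin n} → Adj G′ a b → ¬ SameEdge u v a b → ¬ Walk (removeEdge Gᶜ a b) a b
      other-bridge {a} {b} e other p = bridges e″ (bindʷ (λ iv → proj₁ (deleteVs-InV⁻ G mid iv)) expand p)
        where
        e″ = proj₁ (deleteVs-Adj⁻ G mid e)
        a∉ = proj₂ (deleteVs-InV⁻ G mid (Adj⇒InVˡ ud′ e))
        b∉ = proj₂ (deleteVs-InV⁻ G mid (Adj⇒InVʳ ud′ e))
        off-path : a ∉ L ⊎ b ∉ L
        off-path with a ∈? L | b ∈? L
        ... | no a∉L | _      = inj₁ a∉L
        ... | yes _  | no b∉L = inj₂ b∉L
        ... | yes a∈L | yes b∈L with ∈L⇒end a∈L a∉ | ∈L⇒end b∈L b∉
        ...   | inj₁ refl | inj₁ refl = ⊥-elim (proj₁ (proj₂ wf) _ e″)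
        ...   | inj₂ refl | inj₂ refl = ⊥-elim (proj₁ (proj₂ wf) _ e″)
        ...   | inj₁ refl | inj₂ refl = ⊥-elim (other (inj₁ (refl , refl)))
        ...   | inj₂ refl | inj₁ refl = ⊥-elim (other (inj₂ (refl , refl)))
        differs : x ∈ L → y ∈ L → ¬ SameEdge a b x y
        differs x∈ y∈ same with off-path | same
        ... | inj₁ a∉L | inj₁ (refl , _) = a∉L x∈
        ... | inj₁ a∉L | inj₂ (_ , refl) = a∉L y∈
        ... | inj₂ b∉L | inj₁ (_ , refl) = b∉L y∈
        ... | inj₂ b∉L | inj₂ (refl , _) = b∉L x∈
        path : Walk (removeEdge G a b) u v
        path = walk-from-head (removeEdge-Undirected G a b ud)
          (Consecutive-mono L (λ _ iv → iv) (λ x∈ y∈ e → removeEdge-Adj⁺ G a b e (differs x∈ y∈)) path-consecutive)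
          (there (∈-++⁺ʳ mid (here refl)))
        expand : Adj (removeEdge Gᶜ a b) x y → Walk (removeEdge G a b) x y
        expand e with removeEdge-Adj⁻ Gᶜ a b e
        ... | e′ , other′ with Gᶜ-Adj⁻-mid e′
        ...   | inj₁ (g , _) = edgeʷ (removeEdge-Undirected G a b ud) (removeEdge-Adj⁺ G a b g other′)
        ...   | inj₂ (inj₁ (refl , refl)) = path
        ...   | inj₂ (inj₂ (refl , refl)) = reverseʷ (removeEdge-Undirected G a b ud) path

    AllBridges-Gᶜ : AllBridges Gᶜ
    AllBridges-Gᶜ {a} {b} e with Gᶜ-Adj⁻ e
    ... | inj₂ same = uv-bridge same
    ... | inj₁ e′ with ((a ≟ u) ×-dec (b ≟ v)) ⊎-dec ((a ≟ v) ×-dec (b ≟ u))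
    ...   | yes same = uv-bridge same
    ...   | no other = other-bridge e′ other

    private
      last-interior : ∃[ m ] m ∈ mid × Adj G v m
      last-interior = go mid (proj₁ (proj₂ cp)) path-consecutive
        where
        go : ∀ ms → ms ≢ [] → Consecutive G (u ∷ ms ++ [ v ]) → ∃[ m ] m ∈ ms × Adj G v m
        go ms ms≢[] c with initLast ms
        ... | []         = ⊥-elim (ms≢[] refl)
        ... | init ∷ʳ′ m = m , ∈-++⁺ʳ init (here refl) ,
          Adj-sym ud (proj₁ (Consecutive-++⁻ʳ (u ∷ init) (subst (Consecutive G) (cong (u ∷_) (++-assoc init [ m ] [ v ])) c)))

      from-end : {x y : Fin n} → SameEdge u v x y → 3 ≤ deg G x → ∃[ m ] m ∈ mid × Adj G x m
               → (∀ {a b} → a ∈ mid → b ∈ mid → Walk (G ∖ x) a b)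
               → ∃[ w ] InV G w × w ∉ mid × w ≢ u × w ≢ v
      from-end {x} {y} ends wide (m , m∈ , xm) segment with third-neighbour G wide m y
      ... | w , xw , w≢m , w≢y with w ∈? mid
      ...   | yes w∈ = ⊥-elim (bridges⇒no-detour ud bridges xw xm w≢m (segment m∈ w∈))
      ...   | no w∉ with ends
      ...     | inj₁ (refl , refl) = w , Adj⇒InVʳ ud xw , w∉ , w≢x , w≢y
        where w≢x = λ { refl → proj₁ (proj₂ wf) _ xw }
      ...     | inj₂ (refl , refl) = w , Adj⇒InVʳ ud xw , w∉ , w≢y , w≢x
        where w≢x = λ { refl → proj₁ (proj₂ wf) _ xw }

    off-path-vertex : ∃[ w ] InV G w × w ∉ mid × w ≢ u × w ≢ v
    off-path-vertex with proj₂ (proj₂ (proj₂ cp))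
    ... | inj₁ (wide , _)        = from-end (inj₁ (refl , refl)) wide first-interior mid-avoiding-u
    ... | inj₂ (inj₁ (wide , _)) = from-end (inj₁ (refl , refl)) wide first-interior mid-avoiding-u
    ... | inj₂ (inj₂ (_ , wide)) = from-end (inj₂ (refl , refl)) wide last-interior mid-avoiding-v

    module _ (F : List (Fin n × Fin n)) (within : EdgesWithin Gᶜ F) (two-connectedᶜ : TwoConnected (addEdges Gᶜ F)) where

      private
        G⁺ : Graph n
        G⁺ = addEdges G F
        Gᶜ⁺ : Graph n
        Gᶜ⁺ = addEdges Gᶜ F
        ud-G⁺ : Undirected G⁺
        ud-G⁺ = addEdges-Undirected ud (EdgesWithin-mono {G = Gᶜ} {H = G} (proj₁ ∘ deleteVs-InV⁻ G mid) within)
        ud-G⁺∖ : Undirected (G⁺ ∖ z)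
        ud-G⁺∖ {z = z} = deleteVs-Undirected [ z ] ud-G⁺

      Gᶜ⁺-Adj⁻ : Adj Gᶜ⁺ x y → Adj G⁺ x y ⊎ SameEdge u v x y
      Gᶜ⁺-Adj⁻ e with addEdges-Adj⁻ Gᶜ F e
      ... | inj₂ new = inj₁ (addEdges-Adj⁺ʳ G F new)
      ... | inj₁ old with Gᶜ-Adj⁻-mid old
      ...   | inj₁ (g , _) = inj₁ (addEdges-Adj⁺ˡ G F g)
      ...   | inj₂ same    = inj₂ same

      -- the contracted edge {u , v} is expanded back into the path
      expandʷ : (y z : Fin n) → (∀ {c} → InV Gᶜ c → c ≢ y → c ≢ z) → (u ≢ y → v ≢ y → Walk (G⁺ ∖ z) u v)
              → Walk (Gᶜ⁺ ∖ y) a b → Walk (G⁺ ∖ z) a b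
      expandʷ y z survives expand-uv = bindʷ onV onE
        where
        onV : InV (Gᶜ⁺ ∖ y) c → InV (G⁺ ∖ z) c
        onV ic = let (ic′ , c≢y) = ∖-InV⁻ Gᶜ⁺ ic
                 in ∖-InV⁺ G⁺ (proj₁ (deleteVs-InV⁻ G mid ic′)) (survives ic′ c≢y)
        survivor : InV (Gᶜ⁺ ∖ y) c → c ≢ y
        survivor = proj₂ ∘ ∖-InV⁻ Gᶜ⁺
        onE : Adj (Gᶜ⁺ ∖ y) c d → Walk (G⁺ ∖ z) c d
        onE e with deleteVs-Adj⁻ Gᶜ⁺ [ y ] e
        ... | e′ , ic , id with Gᶜ⁺-Adj⁻ e′
        ...   | inj₁ h = edgeʷ ud-G⁺∖ (deleteVs-Adj⁺ G⁺ [ z ] h (onV ic) (onV id))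
        ...   | inj₂ (inj₁ (refl , refl)) = expand-uv (survivor ic) (survivor id)
        ...   | inj₂ (inj₂ (refl , refl)) = reverseʷ ud-G⁺∖ (expand-uv (survivor id) (survivor ic))

      private
        connectedᶜ∖ : InV Gᶜ y → InV (Gᶜ⁺ ∖ y) a → InV (Gᶜ⁺ ∖ y) b → Walk (Gᶜ⁺ ∖ y) a b
        connectedᶜ∖ iy ia ib = proj₂ (proj₂ two-connectedᶜ _ iy) _ _ ia ib

        lift⁺ : Walk (G ∖ z) x y → Walk (G⁺ ∖ z) x y
        lift⁺ = mapʷ (∖-mono (addEdges-⊒ G F))

        InV-Gᶜ⁺∖ : InV G c → c ∉ mid → c ≢ z → InV (Gᶜ⁺ ∖ z) c
        InV-Gᶜ⁺∖ ic c∉ = ∖-InV⁺ Gᶜ⁺ (deleteVs-InV⁺ G mid ic c∉)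

      delete-off-interior : InV G z → z ∉ mid → (h : Fin n) → InV Gᶜ h → h ≢ z
                          → (∀ {a} → a ∈ mid → Walk (G⁺ ∖ z) a h) → Connected (G⁺ ∖ z)
      delete-off-interior {z = z} iz z∉ h ih h≢z interior-to-h =
        hub⇒Connected ud-G⁺∖ (∖-InV⁺ G⁺ (proj₁ (deleteVs-InV⁻ G mid ih)) h≢z) to-h
        where
        expand-uv : u ≢ z → v ≢ z → Walk (G⁺ ∖ z) u v
        expand-uv u≢z v≢z = lift⁺ (path-avoiding λ where
          (here z≡u)             → u≢z (sym z≡u)
          (there z∈) → [ z∉ , (λ { (here z≡v) → v≢z (sym z≡v) }) ]′ (∈-++⁻ mid z∈))
        to-h : InV (G⁺ ∖ z) c → Walk (G⁺ ∖ z) c h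
        to-h {c} ic with ∖-InV⁻ G⁺ ic | c ∈? mid
        ... | _         | yes c∈ = interior-to-h c∈
        ... | ic′ , c≢z | no c∉  = expandʷ z z (λ _ c≢z → c≢z) expand-uv
          (connectedᶜ∖ (deleteVs-InV⁺ G mid iz z∉) (InV-Gᶜ⁺∖ ic′ c∉ c≢z) (∖-InV⁺ Gᶜ⁺ ih h≢z))

      -- with an interior vertex z gone, v still reaches u around a vertex w off the path
      delete-interior : z ∈ mid → Connected (G⁺ ∖ z)
      delete-interior {z = z} z∈ with ∈-∃++ z∈
      ... | pre , post , mid≡ = hub⇒Connected ud-G⁺∖ (∖-InV⁺ G⁺ iu u≢z) to-u
        where
        u≢z : u ≢ z
        u≢z refl = u∉mid z∈
        avoiding : (y : Fin n) → y ≡ u ⊎ y ≡ v → Walk (Gᶜ⁺ ∖ y) a b → Walk (G⁺ ∖ z) a b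
        avoiding y end = expandʷ y z (λ ic _ c≡z → proj₂ (deleteVs-InV⁻ G mid ic) (subst (_∈ mid) (sym c≡z) z∈))
          λ u≢y v≢y → ⊥-elim ([ u≢y ∘ sym , v≢y ∘ sym ]′ end)
        v-to-u : Walk (G⁺ ∖ z) v u
        v-to-u with off-path-vertex
        ... | w , iw , w∉ , w≢u , w≢v =
              avoiding u (inj₁ refl) (connectedᶜ∖ iuᶜ (InV-Gᶜ⁺∖ iv v∉mid (u≢v ∘ sym)) (InV-Gᶜ⁺∖ iw w∉ w≢u))
          ++ʷ avoiding v (inj₂ refl) (connectedᶜ∖ ivᶜ (InV-Gᶜ⁺∖ iw w∉ w≢v) (InV-Gᶜ⁺∖ iu u∉mid u≢v))
        L≡ : L ≡ (u ∷ pre) ++ z ∷ post ++ [ v ]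
        L≡ = trans (cong (λ m → u ∷ m ++ [ v ]) mid≡) (cong (u ∷_) (++-assoc pre (z ∷ post) [ v ]))
        split-unique = subst Unique L≡ path-unique
        split-consecutive = subst (Consecutive G) L≡ path-consecutive
        before : c ∈ pre → Walk (G ∖ z) c u
        before c∈ = segment-walk ud (u ∷ pre) (Consecutive-++⁻ˡ ud (u ∷ pre) split-consecutive)
          (Unique-++-disjoint (u ∷ pre) split-unique (here refl)) (there c∈) (here refl)
        after : c ∈ post → Walk (G ∖ z) c v
        after c∈ = segment-walk ud (post ++ [ v ]) (Consecutive-++⁻ʳ [ z ] (Consecutive-++⁻ʳ (u ∷ pre) split-consecutive))
          (Unique[x∷xs]⇒x∉xs (Unique-++⁻ʳ (u ∷ pre) split-unique)) (∈-++⁺ˡ c∈) (∈-++⁺ʳ post (here refl))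
        to-u : InV (G⁺ ∖ z) c → Walk (G⁺ ∖ z) c u
        to-u {c} ic with ∖-InV⁻ G⁺ ic | c ∈? mid
        ... | ic′ , c≢z | yes c∈ with ∈-++⁻ pre (subst (c ∈_) mid≡ c∈)
        ...   | inj₁ c∈pre          = lift⁺ (before c∈pre)
        ...   | inj₂ (here refl)    = ⊥-elim (c≢z refl)
        ...   | inj₂ (there c∈post) = lift⁺ (after c∈post) ++ʷ v-to-u
        to-u {c} ic | ic′ , c≢z | no c∉ with c ≟ v
        ...   | yes refl = v-to-u
        ...   | no c≢v   = avoiding v (inj₂ refl)
                  (connectedᶜ∖ ivᶜ (InV-Gᶜ⁺∖ ic′ c∉ c≢v) (InV-Gᶜ⁺∖ iu u∉mid u≢v))

      TwoConnected-G⁺ : TwoConnected G⁺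
      TwoConnected-G⁺ with first-interior
      ... | m₁ , m₁∈ , um₁ =
        Connected-∖⇒Connected ud-G⁺ (addEdges-Adj⁺ˡ G F um₁) (λ { refl → u∉mid m₁∈ }) (delete u iu) , delete
        where
        delete : ∀ z → InV G⁺ z → Connected (G⁺ ∖ z)
        delete z iz with z ∈? mid
        ... | yes z∈ = delete-interior z∈
        ... | no z∉ with z ≟ u
        ...   | no z≢u   = delete-off-interior iz z∉ u iuᶜ (z≢u ∘ sym)
                             λ a∈ → lift⁺ (prefix-avoiding z∉prefix (there a∈) (here refl))
          where
          z∉prefix : z ∉ u ∷ mid
          z∉prefix (here z≡u) = z≢u z≡u
          z∉prefix (there z∈) = z∉ z∈
        ...   | yes refl = delete-off-interior iz z∉ v ivᶜ (u≢v ∘ sym)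
                             λ a∈ → lift⁺ (suffix-avoiding u∉suffix (∈-++⁺ˡ a∈) (∈-++⁺ʳ mid (here refl)))

  Treelike-Gᶜ : Treelike G → Treelike Gᶜ
  Treelike-Gᶜ treelike = record
    { wellFormed = WellFormed-Gᶜ
    ; connected  = Connected-Gᶜ (Treelike.connected treelike)
    ; bridges    = AllBridges-Gᶜ (Treelike.bridges treelike) }

contracted-InV : {C : Graph n} → FullyContracted G C → InV C x → InV G x
contracted-InV (done _)               ix = ix
contracted-InV {G = G} (step _ mid _ _ rest) ix = proj₁ (deleteVs-InV⁻ G mid (contracted-InV rest ix))

EdgesWithin-uncontract : {C : Graph n} → FullyContracted G C → EdgesWithin C F → EdgesWithin G F
EdgesWithin-uncontract {G = G} {C = C} fc = EdgesWithin-mono {G = C} {H = G} (contracted-InV fc)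

Treelike-contracted : {C : Graph n} → FullyContracted G C → Treelike G → Treelike C
Treelike-contracted (done _)             treelike = treelike
Treelike-contracted (step _ _ _ cp rest) treelike =
  Treelike-contracted rest (Contraction.Treelike-Gᶜ (Treelike.wellFormed treelike) cp treelike)

TwoConnected-uncontract : {C : Graph n} → FullyContracted G C → Treelike G → EdgesWithin C F
                        → TwoConnected (addEdges C F) → TwoConnected (addEdges G F)
TwoConnected-uncontract (done _) _ _ tc = tc
TwoConnected-uncontract {F = F} (step _ _ _ cp rest) treelike within tc =
  Contraction.TwoConnected-G⁺ wf cp (Treelike.bridges treelike) F (EdgesWithin-uncontract rest within)
    (TwoConnected-uncontract rest (Contraction.Treelike-Gᶜ wf cp treelike) within tc)
  where wf = Treelike.wellFormed treelike

augment-TwoConnected : Treelike G → TreeAugment G F → TwoConnected (addEdges G F) × EdgesWithin G F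
augment-TwoConnected treelike (twoLeaves x y (leaf-x , leaf-y , rest)) =
  two-leaves-TwoConnected treelike (leaf-x , leaf-y , rest) , (proj₁ leaf-x , proj₁ leaf-y) ∷ []
augment-TwoConnected treelike (star F R _ fc _ _ (_ , leaves , tc)) =
  TwoConnected-uncontract fc treelike within tc , EdgesWithin-uncontract fc within
  where within = All.map (λ (leaf-x , leaf-y , _) → proj₁ leaf-x , proj₁ leaf-y) leaves
-- Which representatives are chosen, and how many leaves t are paired, does not matter here.
augment-TwoConnected treelike
  (nonStar {C = C} Rᵢ Rⱼ xs ys _ fc (iRᵢ , wideᵢ , _ , Rᵢt , _) (iRⱼ , wideⱼ , _) Rᵢ≢Rⱼ _ _
           len-xs len-ys _ _ xs-leaves ys-leaves rest)
  = TwoConnected-uncontract fc treelike within tc , EdgesWithin-uncontract fc within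
  where
  treelike-C = Treelike-contracted fc treelike
  S = xs ++ ys
  leaves : ∀ {s} → s ∈ S → deg C s ≡ 1
  leaves s∈ = [ proj₂ ∘ proj₂ ∘ lookup xs-leaves , proj₂ ∘ proj₂ ∘ lookup ys-leaves ]′ (∈-++⁻ xs s∈)
  wide∉S : 3 ≤ deg C x → x ∉ S
  wide∉S wide x∈ with subst (3 ≤_) (leaves x∈) wide
  ... | s≤s ()
  Rᵢ∉ = wide∉S wideᵢ
  Rⱼ∉ = wide∉S wideⱼ
  ih = augment-TwoConnected (Treelike-delete-leaves treelike-C leaves (deleteVs-InV⁺ C S iRᵢ Rᵢ∉)) rest
  open Ear (Treelike.wellFormed treelike-C) Rᵢ≢Rⱼ Rᵢ∉ Rⱼ∉ iRᵢ iRⱼ (All.map proj₁ xs-leaves) (All.map proj₁ ys-leaves)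
           (trans len-xs (sym len-ys)) (proj₂ ih) (proj₁ ih)
  tc = ear-TwoConnected Rᵢt

theorem2 : ∀ {n} (T : Graph n) (F : List (Fin n × Fin n))
           → Tree T → TreeAugment T F → TwoConnected (addEdges T F)
theorem2 T F tree augment = proj₁ (augment-TwoConnected (Tree⇒Treelike tree) augment)
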